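{- Let $\ell \geqslant 1$ be an integer and $G$ a finite connected graph with $\Delta(G) \geqslant 2$. Let $D := D(G)$ and, for each $k \geqslant 1$, $D_k := D(\mathcal{E}_k(G))$. If $G$ contains a cycle, then $D = D_\ell$. Otherwise $G$ is a tree of some diameter $s \geqslant 2$, and $D = D_1 \supseteq D_2 \supseteq \cdots \supseteq D_{s-1} \supsetneq \emptyset = D_s = D_{s+1} = \cdots$.
   Context: Graphs are undirected and loopless and may have parallel edges. For $k \geqslant 1$, a $k$-link of a graph is a walk $[v_0, e_1, \ldots, e_k, v_k]$ in which consecutive edges are different, identified with its reverse. The $k$-link graph $\mathbb{L}_k(G)$ has as vertices the $k$-links of $G$, and each $(k+1)$-link $[v_0, e_1, \ldots, e_{k+1}, v_{k+1}]$ is an edge joining $[v_0, \ldots, e_k, v_k]$ and $[v_1, \ldots, e_{k+1}, v_{k+1}]$. $\mathcal{E}_k(G)$ is the partition of $E(\mathbb{L}_k(G))$ in which two edges are in the same part iff their $(k+1)$-links have the same middle $(k-1)$-link $[v_1, \ldots, e_k, v_k]$. For a partition $\mathcal{E}$ of the edge set of a graph $H$, $D(\mathcal{E})$ is the set of values $\deg_E(v)$ over all $v \in V(H)$ and all parts $E \in \mathcal{E}$ incident to $v$, where $\deg_E(v)$ is the degree of $v$ in the subgraph of $H$ formed by the edges in $E$. $D(G) := \{\deg_G(v) - 1 : v \in V(G)\} \cap \{1, 2, \ldots\}$. -}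

module Defs where

open import Data.Nat using (ℕ; zero; suc; _≤_; _<_; _∸_)
open import Data.Fin using (Fin; toℕ; inject₁) renaming (suc to fsuc)
open import Data.Vec using (Vec; lookup; init; tail; reverse)
open import Data.Product using (Σ; ∃; _×_; _,_)
open import Data.Sum using (_⊎_)
open import Data.Empty using (⊥)
open import Relation.Nullary using (¬_)
open import Relation.Binary.PropositionalEquality using (_≡_; _≢_)

-- Finite, undirected, loopless multigraphs.
-- Vertices are Fin n, edges are Fin m; edge e has ends src e and tgt e
-- (the orientation carries no meaning); parallel edges are allowed.

record Graph : Set where
  field
    n        : ℕ
    m        : ℕ
    src      : Fin m → Fin n
    tgt      : Fin m → Fin n
    loopless : ∀ e → src e ≢ tgt e

module _ (G : Graph) where
  open Graph G

  V : Set
  V = Fin n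

  E : Set
  E = Fin m

  Joins : E → V → V → Set
  Joins e u v = (src e ≡ u × tgt e ≡ v) ⊎ (src e ≡ v × tgt e ≡ u)

  IsEnd : V → E → Set
  IsEnd v e = (src e ≡ v) ⊎ (tgt e ≡ v)

  Adj : V → V → Set
  Adj u v = Σ E λ e → Joins e u v

-- Cardinality of the set of equivalence classes (w.r.t. _≈_) of elements
-- of A satisfying P is d: there is a list f of d representatives,
-- pairwise inequivalent, meeting every class of P-elements.
-- (With _≈_ = _≡_ this is the ordinary cardinality of {a | P a}.)

Card : {A : Set} → (A → A → Set) → (A → Set) → ℕ → Set
Card {A} _≈_ P d =
  Σ (Fin d → A) λ f →
      (∀ i → P (f i))
    × (∀ i j → f i ≈ f j → i ≡ j)
    × (∀ a → P a → Σ (Fin d) λ i → f i ≈ a)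

NatSet : Set₁
NatSet = ℕ → Set

_≐_ : NatSet → NatSet → Set
A ≐ B = ∀ d → (A d → B d) × (B d → A d)

_⊆_ : NatSet → NatSet → Set
A ⊆ B = ∀ d → A d → B d

Nonempty : NatSet → Set
Nonempty A = Σ ℕ A

Empty : NatSet → Set
Empty A = ∀ d → ¬ A d

module _ (G : Graph) where
  open Graph G

  deg : V G → ℕ → Set
  deg v d = Card _≡_ (IsEnd G v) d

  MaxDeg≥2 : Set
  MaxDeg≥2 = Σ (V G) λ v → Σ ℕ λ d → deg v d × 2 ≤ d

  -- D(G) = {deg(v) - 1 : v ∈ V(G)} ∩ {1,2,...}
  DG : NatSet
  DG d = 1 ≤ d × Σ (V G) λ v → deg v (suc d)

  data Reach : ℕ → V G → V G → Set where
    here  : ∀ {u} → Reach 0 u u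
    there : ∀ {k u v w} → Adj G u v → Reach k v w → Reach (suc k) u w

  Connected : Set
  Connected = ∀ u v → Σ ℕ λ k → Reach k u v

  Dist : V G → V G → ℕ → Set
  Dist u v d = Reach d u v × (∀ k → k < d → ¬ Reach k u v)

  Diameter : ℕ → Set
  Diameter s = (Σ (V G) λ u → Σ (V G) λ v → Dist u v s)
             × (∀ u v d → Dist u v d → d ≤ s)

  -- cycles: k ≥ 2 distinct vertices c 0 … c (k-1) and k distinct edges,
  -- edge i joining c i and c (i+1 mod k).  (k = 2: two parallel edges.)

  HasCycle : Set
  HasCycle =
    Σ ℕ λ k → Σ (Fin (suc (suc k)) → V G) λ c → Σ (Fin (suc (suc k)) → E G) λ ed →
        (∀ i j → c i ≡ c j → i ≡ j)
      × (∀ i j → ed i ≡ ed j → i ≡ j)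
      × (∀ (i : Fin (suc k)) → Joins G (ed (inject₁ i)) (c (inject₁ i)) (c (fsuc i)))
      × Joins G (ed (Data.Fin.fromℕ (suc k))) (c (Data.Fin.fromℕ (suc k))) (c Data.Fin.zero)

  -- k-links.  A raw walk of length k is [v0, e1, …, ek, vk], stored as
  -- the vector of its k+1 vertices and the vector of its k edges.

  RawWalk : ℕ → Set
  RawWalk k = Vec (V G) (suc k) × Vec (E G) k

  IsLink : (k : ℕ) → RawWalk k → Set
  IsLink k (vs , es) =
      (∀ (i : Fin k) → Joins G (lookup es i) (lookup vs (inject₁ i)) (lookup vs (fsuc i)))
    × (∀ (i j : Fin k) → toℕ j ≡ suc (toℕ i) → lookup es i ≢ lookup es j)

  rev : ∀ {k} → RawWalk k → RawWalk k
  rev (vs , es) = reverse vs , reverse es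

  _≈L_ : ∀ {k} → RawWalk k → RawWalk k → Set
  w ≈L w' = (w ≡ w') ⊎ (w ≡ rev w')

  prefix : ∀ {k} → RawWalk (suc k) → RawWalk k
  prefix (vs , es) = init vs , init es

  suffix : ∀ {k} → RawWalk (suc k) → RawWalk k
  suffix (vs , es) = tail vs , tail es

  middle : ∀ {j} → RawWalk (suc (suc j)) → RawWalk j
  middle w = prefix (suffix w)

  -- In 𝕃_k(G) the edge given by the (k+1)-link w is incident to the
  -- vertex given by the k-link x
  Incident : ∀ {k} → RawWalk (suc k) → RawWalk k → Set
  Incident w x = (prefix w ≈L x) ⊎ (suffix w ≈L x)

  -- deg_E(x) in 𝕃_k(G), k = suc j, where E ∈ ℰ_k(G) is the part whose
  -- edges have middle (k-1)-link (equivalent to) that of the edge w: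
  -- the number of edges (classes of (k+1)-links) in E incident to x.
  -- (𝕃_k(G) has no loops, so no edge is counted twice.)
  degPart : ∀ {j} → RawWalk (suc (suc j)) → RawWalk (suc j) → ℕ → Set
  degPart {j} w x d =
    Card _≈L_ (λ w' → IsLink (suc (suc j)) w' × (middle w' ≈L middle w) × Incident w' x) d

  -- D(ℰ_k(G)) for k ≥ 1 (by convention the empty set for k = 0, unused):
  -- values deg_E(x) over vertices x of 𝕃_k(G) and parts E incident to x
  -- (a part is incident to x iff it contains an edge w incident to x).
  Dk : ℕ → NatSet
  Dk zero d = ⊥
  Dk (suc j) d =
    Σ (RawWalk (suc j)) λ x → Σ (RawWalk (suc (suc j))) λ w →
      IsLink (suc j) x × IsLink (suc (suc j)) w × Incident w x × degPart w x d

module Submission where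

-- The heart of the proof is a characterisation of D_k for k = j + 1 ≥ 1
-- (`witness⇒Dk`, `Dk⇒witness`): d ∈ D_k iff some (k+1)-link [v0, e1, v1, e2, …] has its second
-- vertex v1 of degree d + 1.  Indeed, the k-link x = [v1, …, v(k+1)] is met inside
-- the part with middle link [v1, …, vk] exactly by the (k+1)-links [u, e, x] with
-- e ≠ e2 an edge at v1, so deg_E(x) = deg(v1) − 1 (`degPart-at-suffix`); all other
-- incidences are impossible because a link is never equivalent to its own reverse
-- or shift.  The theorem then becomes a statement about long links:
--   * D = D_1, since a 2-link through v is a pair of distinct edges at v;
--   * D_(k+1) ⊆ D_k, since the prefix of a (k+2)-link keeps its second vertex;
--   * if G has a cycle, every vertex of degree ≥ 2 is the second vertex of
--     arbitrarily long links: walk to the cycle and then around it;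
--   * if G is a tree, a k-link is a non-backtracking walk, hence the unique path
--     between its ends, so k ≤ s = diameter (D_k = ∅ for k ≥ s), while a
--     diametral path is an s-link and provides an element of D_(s−1).

open import Defs
open import Data.Nat using (ℕ; zero; suc; _+_; _≤_; _<_; _∸_; z≤n; s≤s; _≤?_)
open import Data.Nat.Properties
  using (m≤n⇒m≤1+n; m≤n+m; ≤-trans; ≤-refl; ≤-antisym; <⇒≤; ≰⇒>; 1+n≢n; 1+n≰n; 0≢1+n; <-cmp;
         m≤n⇒m<n∨m≡n)
import Data.Nat.Properties as ℕ
open import Data.Fin using (Fin; toℕ; inject₁; fromℕ; punchIn; punchOut; _≟_) renaming (suc to fsuc; zero to fzero)
open import Data.Fin.Properties
  using (injective⇒≤; punchIn-injective; punchInᵢ≢i; punchIn-punchOut; suc-injective; toℕ-inject₁; any?;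
         fromℕ≢inject₁; inject₁-injective)
import Data.Fin.Properties as Fin
open import Data.Fin.Relation.Unary.Top using (view; ‵fromℕ; ‵inj₁)
open import Data.Vec using (Vec; []; _∷_; lookup; init; tail; reverse; head; last; _∷ʳ_)
open import Data.Vec.Properties using (reverse-∷; reverse-involutive; init-reverse; last-reverse)
open import Data.Product using (Σ; _×_; _,_; proj₁; proj₂)
open import Data.Sum using (_⊎_; inj₁; inj₂)
open import Data.Unit using (⊤; tt)
open import Data.Empty using (⊥; ⊥-elim)
open import Relation.Nullary using (¬_; Dec; yes; no)
open import Relation.Nullary.Decidable using (_⊎-dec_)
open import Relation.Binary using (tri<; tri≈; tri>)
open import Relation.Binary.PropositionalEquality using (_≡_; _≢_; refl; sym; trans; cong; cong₂; subst; module ≡-Reasoning)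

card-transport : {A B : Set} {P : A → Set} {_≈_ : B → B → Set} {Q : B → Set} {d : ℕ}
  (f : A → B) → (∀ a → P a → Q (f a)) → (∀ a a' → P a → P a' → f a ≈ f a' → a ≡ a')
  → (∀ b → Q b → Σ A λ a → P a × f a ≈ b)
  → Card _≡_ P d → Card _≈_ Q d
card-transport {P = P} {_≈_} f fP finj fsurj (e , eP , einj , esurj) =
  (λ i → f (e i)) , (λ i → fP (e i) (eP i)) ,
  (λ i j q → einj i j (finj (e i) (e j) (eP i) (eP j) q)) ,
  λ b qb → let (a , pa , fa) = fsurj b qb ; (i , ei) = esurj a pa in
    i , subst (λ z → f z ≈ b) (sym ei) fa

card-≤ : {A : Set} {_≈_ : A → A → Set} {P : A → Set} {d d' : ℕ} →
  (∀ {a b} → a ≈ b → b ≈ a) → (∀ {a b c} → a ≈ b → b ≈ c → a ≈ c) →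
  Card _≈_ P d → Card _≈_ P d' → d ≤ d'
card-≤ {_≈_ = _≈_} sy tr (e , eP , einj , esurj) (g , gP , ginj , gsurj) =
  injective⇒≤ {f = index} λ {i} {j} q → einj i j (same-class i j q)
  where
  index : _ → _
  index i = proj₁ (gsurj (e i) (eP i))
  same-class : ∀ i j → index i ≡ index j → e i ≈ e j
  same-class i j q with gsurj (e i) (eP i) | gsurj (e j) (eP j)
  ... | (k , gk) | (k' , gk') = tr (sy gk) (subst (λ z → g z ≈ e j) (sym q) gk')

card-unique : {A : Set} {_≈_ : A → A → Set} {P : A → Set} {d d' : ℕ} →
  (∀ {a b} → a ≈ b → b ≈ a) → (∀ {a b c} → a ≈ b → b ≈ c → a ≈ c) →
  Card _≈_ P d → Card _≈_ P d' → d ≡ d'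
card-unique sy tr c c' = ≤-antisym (card-≤ sy tr c c') (card-≤ sy tr c' c)

card-decidable : {m : ℕ} (P : Fin m → Set) → (∀ x → Dec (P x)) → Σ ℕ λ d → Card _≡_ P d
card-decidable {zero} P P? = 0 , (λ ()) , (λ ()) , (λ ()) , λ ()
card-decidable {suc m} P P? with card-decidable (λ x → P (fsuc x)) (λ x → P? (fsuc x)) | P? fzero
... | (d , f , fP , finj , fs) | yes p0 =
  suc d , g , gP , ginj , gs
  where
  g : Fin (suc d) → Fin (suc m)
  g fzero = fzero
  g (fsuc i) = fsuc (f i)
  gP : ∀ i → P (g i)
  gP fzero = p0
  gP (fsuc i) = fP i
  ginj : ∀ i j → g i ≡ g j → i ≡ j
  ginj fzero fzero q = refl
  ginj fzero (fsuc j) ()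
  ginj (fsuc i) fzero ()
  ginj (fsuc i) (fsuc j) q = cong fsuc (finj i j (suc-injective q))
  gs : ∀ a → P a → Σ (Fin (suc d)) λ i → g i ≡ a
  gs fzero pa = fzero , refl
  gs (fsuc a) pa = let (i , q) = fs a pa in fsuc i , cong fsuc q
... | (d , f , fP , finj , fs) | no np0 =
  d , (λ i → fsuc (f i)) , fP , (λ i j q → finj i j (suc-injective q)) , gs
  where
  gs : ∀ a → P a → Σ (Fin d) λ i → fsuc (f i) ≡ a
  gs fzero pa = ⊥-elim (np0 pa)
  gs (fsuc a) pa = let (i , q) = fs a pa in i , cong fsuc q

card-remove : {A : Set} {P : A → Set} {d : ℕ} (x : A) → P x →
  Card _≡_ P (suc d) → Card _≡_ (λ y → P y × y ≢ x) d
card-remove {P = P} {d} x px (e , eP , einj , es) =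
  g , (λ j → eP _ , g≢x j) , (λ i j q → punchIn-injective i0 i j (einj _ _ q)) , gs
  where
  i0 : Fin (suc d)
  i0 = proj₁ (es x px)
  ei0 : e i0 ≡ x
  ei0 = proj₂ (es x px)
  g : Fin d → _
  g j = e (punchIn i0 j)
  g≢x : ∀ j → g j ≢ x
  g≢x j q = punchInᵢ≢i i0 j (einj _ _ (trans q (sym ei0)))
  gs : ∀ y → P y × y ≢ x → Σ (Fin d) λ j → g j ≡ y
  gs y (py , ny) with es y py
  ... | (i , ei) = punchOut i0≢i , trans (cong e (punchIn-punchOut i0≢i)) ei
    where
    i0≢i : i0 ≢ i
    i0≢i q = ny (trans (sym ei) (trans (cong e (sym q)) ei0))

card-cong : {A : Set} {_≈_ : A → A → Set} {P Q : A → Set} {d : ℕ} →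
  (∀ a → P a → Q a) → (∀ a → Q a → P a) → Card _≈_ P d → Card _≈_ Q d
card-cong pq qp (f , fP , finj , fs) = f , (λ i → pq _ (fP i)) , finj , λ a qa → fs a (qp a qa)

card-nonzero : {A : Set} {P : A → Set} {d : ℕ} {a : A} → Card _≡_ P d → P a → Σ ℕ λ d' → d ≡ suc d'
card-nonzero {d = zero} (f , fP , finj , fs) pa with fs _ pa
... | () , _
card-nonzero {d = suc d} _ _ = d , refl

card-two-distinct : {A : Set} {P : A → Set} {d : ℕ} {a b : A} →
  Card _≡_ P (suc d) → P a → P b → a ≢ b → 1 ≤ d
card-two-distinct {d = zero} (f , fP , finj , fs) pa pb ab with fs _ pa | fs _ pb
... | fzero , p | fzero , q = ⊥-elim (ab (trans (sym p) q))
card-two-distinct {d = suc d} _ _ _ _ = s≤s z≤n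

card-pair : {A : Set} {P : A → Set} {d : ℕ} → Card _≡_ P (suc d) → 1 ≤ d →
  Σ A λ a → Σ A λ b → P a × P b × a ≢ b
card-pair {d = suc d} (en , enP , eninj , _) _ =
  en fzero , en (fsuc fzero) , enP _ , enP _ , λ q → Fin.0≢1+n (eninj _ _ q)

card-avoid : {m d : ℕ} {P : Fin m → Set} → Card _≡_ P (suc d) → 1 ≤ d →
  (f : Fin m) → Σ (Fin m) λ a → P a × a ≢ f
card-avoid {d = suc d} (en , enP , eninj , _) _ f with en fzero ≟ f
... | yes p = en (fsuc fzero) , enP _ , λ q → Fin.0≢1+n (eninj _ _ (trans p (sym q)))
... | no np = en fzero , enP _ , np

argmax : ∀ {n} (f : Fin (suc n) → ℕ) → Σ (Fin (suc n)) λ i → ∀ j → f j ≤ f i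
argmax {zero} f = fzero , λ { fzero → ≤-refl }
argmax {suc n} f with argmax (λ j → f (fsuc j))
... | i , h with f fzero ≤? f (fsuc i)
... | yes p = fsuc i , λ { fzero → p ; (fsuc j) → h j }
... | no np = fzero , λ { fzero → ≤-refl ; (fsuc j) → ≤-trans (h j) (<⇒≤ (≰⇒> np)) }

argmax-nonempty : ∀ {n} → Fin n → (f : Fin n → ℕ) → Σ (Fin n) λ i → ∀ j → f j ≤ f i
argmax-nonempty {suc n} _ f = argmax f

module _ {A : Set} where
  open ≡-Reasoning

  init-tail : ∀ {n} (v : Vec A (suc (suc n))) → init (tail v) ≡ tail (init v)
  init-tail (a ∷ b ∷ v) = refl

  tail-reverse : ∀ {n} (v : Vec A (suc n)) → tail (reverse v) ≡ reverse (init v)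
  tail-reverse v = begin
    tail (reverse v)                     ≡⟨ sym (reverse-involutive (tail (reverse v))) ⟩
    reverse (reverse (tail (reverse v))) ≡⟨ cong reverse (sym (init-reverse (reverse v))) ⟩
    reverse (init (reverse (reverse v))) ≡⟨ cong (λ u → reverse (init u)) (reverse-involutive v) ⟩
    reverse (init v)                     ∎

  head-reverse : ∀ {n} (v : Vec A (suc n)) → head (reverse v) ≡ last v
  head-reverse v = begin
    head (reverse v)                ≡⟨ sym (last-reverse (reverse v)) ⟩
    last (reverse (reverse v))      ≡⟨ cong last (reverse-involutive v) ⟩
    last v                          ∎

  head-tail-init : ∀ {n} (v : Vec A (suc (suc (suc n)))) → head (tail (init v)) ≡ head (tail v)
  head-tail-init (a ∷ b ∷ c ∷ v) = refl

ConsOK : {A : Set} {k : ℕ} → A → Vec A k → Set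
ConsOK e [] = ⊤
ConsOK e (f ∷ _) = e ≢ f

SnocOK : {A : Set} {k : ℕ} → Vec A k → A → Set
SnocOK [] e = ⊤
SnocOK (f ∷ es) e = last (f ∷ es) ≢ e

module Incidence (G : Graph) where
  open Graph G

  Joins-sym : ∀ {e u v} → Joins G e u v → Joins G e v u
  Joins-sym (inj₁ pq) = inj₂ pq
  Joins-sym (inj₂ pq) = inj₁ pq

  Joins-end : ∀ {e u v} → Joins G e u v → IsEnd G u e
  Joins-end (inj₁ (p , q)) = inj₁ p
  Joins-end (inj₂ (p , q)) = inj₂ q

  Joins-distinct : ∀ {e u v} → Joins G e u v → u ≢ v
  Joins-distinct {e} (inj₁ (p , q)) uv = loopless e (trans p (trans uv (sym q)))
  Joins-distinct {e} (inj₂ (p , q)) uv = loopless e (trans p (trans (sym uv) (sym q)))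

  Joins-other-end : ∀ {e u v w} → Joins G e u v → Joins G e u w → v ≡ w
  Joins-other-end (inj₁ (p , q)) (inj₁ (p' , q')) = trans (sym q) q'
  Joins-other-end {e} (inj₁ (p , q)) (inj₂ (p' , q')) = ⊥-elim (loopless e (trans p (sym q')))
  Joins-other-end {e} (inj₂ (p , q)) (inj₁ (p' , q')) = ⊥-elim (loopless e (trans p' (sym q)))
  Joins-other-end (inj₂ (p , q)) (inj₂ (p' , q')) = trans (sym p) p'

  Joins-ends : ∀ {e u v a b} → Joins G e u v → Joins G e a b → (u ≡ a) ⊎ (u ≡ b)
  Joins-ends (inj₁ (p , q)) (inj₁ (p' , q')) = inj₁ (trans (sym p) p')
  Joins-ends (inj₁ (p , q)) (inj₂ (p' , q')) = inj₂ (trans (sym p) p')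
  Joins-ends (inj₂ (p , q)) (inj₁ (p' , q')) = inj₂ (trans (sym q) q')
  Joins-ends (inj₂ (p , q)) (inj₂ (p' , q')) = inj₁ (trans (sym q) q')

  -- The end of e opposite to h (meaningful when h is an end of e).
  otherEnd : V G → E G → V G
  otherEnd h e with src e ≟ h
  ... | yes _ = tgt e
  ... | no _ = src e

  otherEnd-joins : ∀ {h e} → IsEnd G h e → Joins G e (otherEnd h e) h
  otherEnd-joins {h} {e} ie with src e ≟ h
  ... | yes p = inj₂ (p , refl)
  ... | no np with ie
  ...   | inj₁ p = ⊥-elim (np p)
  ...   | inj₂ q = inj₁ (refl , q)

  otherEnd-unique : ∀ {h e p} → Joins G e p h → p ≡ otherEnd h e
  otherEnd-unique j = Joins-other-end (Joins-sym j) (Joins-sym (otherEnd-joins (Joins-end (Joins-sym j))))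

  deg-exists : (v : V G) → Σ ℕ λ d → deg G v d
  deg-exists v = card-decidable (IsEnd G v) (λ e → (src e ≟ v) ⊎-dec (tgt e ≟ v))

module Links (G : Graph) where
  open Incidence G

  link-cons : ∀ {k a e} {vs : Vec (V G) (suc k)} {es : Vec (E G) k} →
    Joins G e a (head vs) → ConsOK e es → IsLink G k (vs , es) → IsLink G (suc k) (a ∷ vs , e ∷ es)
  link-cons {e = e} {vs = v ∷ vs} {es} j ok (lj , ld) = joins , distinct
    where
    joins : _
    joins fzero = j
    joins (fsuc i) = lj i
    consOK-first : ∀ {k} (fs : Vec (E G) (suc k)) → ConsOK e fs → e ≢ lookup fs fzero
    consOK-first (f ∷ fs) ok = ok
    distinct : _
    distinct fzero fzero ()
    distinct fzero (fsuc fzero) q = consOK-first es ok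
    distinct fzero (fsuc (fsuc j)) ()
    distinct (fsuc i) fzero ()
    distinct (fsuc i) (fsuc j) q = ld i j (ℕ.suc-injective q)

  link-uncons : ∀ {k a e} {vs : Vec (V G) (suc k)} {es : Vec (E G) k} →
    IsLink G (suc k) (a ∷ vs , e ∷ es) → Joins G e a (head vs) × ConsOK e es × IsLink G k (vs , es)
  link-uncons {vs = v ∷ vs} {es} (lj , ld) =
    lj fzero , consOK es ld , (λ i → lj (fsuc i)) , λ i j q → ld (fsuc i) (fsuc j) (cong suc q)
    where
    consOK : ∀ {k} (es : Vec _ k) →
      (∀ (i j : Fin (suc k)) → toℕ j ≡ suc (toℕ i) → lookup (_ ∷ es) i ≢ lookup (_ ∷ es) j) → ConsOK _ es
    consOK [] _ = tt
    consOK (f ∷ es) d = d fzero (fsuc fzero) refl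

  link-suffix : ∀ {k} {w : RawWalk G (suc k)} → IsLink G (suc k) w → IsLink G k (suffix G w)
  link-suffix {w = a ∷ vs , e ∷ es} l = proj₂ (proj₂ (link-uncons l))

  link-first-edge : ∀ {k} {w : RawWalk G (suc k)} → IsLink G (suc k) w →
    Joins G (head (proj₂ w)) (head (proj₁ w)) (head (tail (proj₁ w)))
  link-first-edge {w = a ∷ v ∷ vs , e ∷ es} l = proj₁ (link-uncons l)

  link-zero : ∀ (vs : Vec (V G) 1) (es : Vec (E G) 0) → IsLink G 0 (vs , es)
  link-zero vs es = (λ ()) , λ ()

  link-prefix : ∀ {k} {w : RawWalk G (suc k)} → IsLink G (suc k) w → IsLink G k (prefix G w)
  link-prefix {zero} {vs , es} l = link-zero (init vs) (init es)
  link-prefix {suc k} {a ∷ b ∷ vs , e ∷ f ∷ es} l with link-uncons l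
  ... | j , ok , l' = link-cons {vs = init (b ∷ vs)} (joins-head vs j) (consOK-init es ok)
                        (link-prefix {k} {b ∷ vs , f ∷ es} l')
    where
    joins-head : ∀ {n} (vs : Vec _ (suc n)) → Joins G e a b → Joins G e a (head (init (b ∷ vs)))
    joins-head (c ∷ vs) j = j
    consOK-init : ∀ {n} (es : Vec _ n) → e ≢ f → ConsOK e (init (f ∷ es))
    consOK-init [] _ = tt
    consOK-init (g ∷ es) ok = ok

  middle-link : ∀ {j} {w : RawWalk G (suc (suc j))} → IsLink G (suc (suc j)) w → IsLink G j (middle G w)
  middle-link {w = w} l = link-prefix {w = suffix G w} (link-suffix {w = w} l)

  link-snoc : ∀ {k e v} {vs : Vec (V G) (suc k)} {es : Vec (E G) k} →
    IsLink G k (vs , es) → Joins G e (last vs) v → SnocOK es e → IsLink G (suc k) (vs ∷ʳ v , es ∷ʳ e)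
  link-snoc {zero} {v = v} {vs = a ∷ []} {[]} l j ok = link-cons j tt (link-zero (v ∷ []) [])
  link-snoc {suc zero} {vs = a ∷ b ∷ []} {f ∷ []} l j ok =
    link-cons (proj₁ (link-uncons l)) ok (link-snoc {zero} {vs = b ∷ []} {[]} (link-zero (b ∷ []) []) j tt)
  link-snoc {suc (suc k)} {v = v} {vs = a ∷ b ∷ vs} {f ∷ g ∷ es} l j ok =
    link-cons {vs = (b ∷ vs) ∷ʳ v} (proj₁ (link-uncons l)) (proj₁ (proj₂ (link-uncons l)))
      (link-snoc {suc k} {vs = b ∷ vs} {g ∷ es} (proj₂ (proj₂ (link-uncons l))) j ok)

  rev-cons : ∀ {k} (a : V G) (e : E G) (vs : Vec (V G) (suc k)) (es : Vec (E G) k) →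
    rev G (a ∷ vs , e ∷ es) ≡ (reverse vs ∷ʳ a , reverse es ∷ʳ e)
  rev-cons a e vs es = cong₂ _,_ (reverse-∷ a vs) (reverse-∷ e es)

  link-rev : ∀ {k} {w : RawWalk G k} → IsLink G k w → IsLink G k (rev G w)
  link-rev {zero} {vs , es} l = link-zero (reverse vs) (reverse es)
  link-rev {suc k} {a ∷ vs , e ∷ es} l with link-uncons l
  ... | j , ok , l' = subst (IsLink G (suc k)) (sym (rev-cons a e vs es))
        (link-snoc (link-rev {w = vs , es} l') (subst (λ z → Joins G e z a) (sym (last-reverse vs)) (Joins-sym j))
          (snocOK-reverse es ok))
    where
    snocOK-last : ∀ {n} (xs : Vec _ (suc n)) → last xs ≢ e → SnocOK xs e
    snocOK-last (x ∷ xs) ne = ne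
    snocOK-reverse : ∀ {n} (es : Vec _ n) → ConsOK e es → SnocOK (reverse es) e
    snocOK-reverse [] _ = tt
    snocOK-reverse (f ∷ es) ok =
      snocOK-last (reverse (f ∷ es)) (subst (_≢ e) (sym (last-reverse (f ∷ es))) (λ q → ok (sym q)))

  rev-involutive : ∀ {k} (w : RawWalk G k) → rev G (rev G w) ≡ w
  rev-involutive (vs , es) = cong₂ _,_ (reverse-involutive vs) (reverse-involutive es)

  ≈-sym : ∀ {k} {w w' : RawWalk G k} → _≈L_ G w w' → _≈L_ G w' w
  ≈-sym (inj₁ p) = inj₁ (sym p)
  ≈-sym {w = w} {w'} (inj₂ p) = inj₂ (trans (sym (rev-involutive w')) (cong (rev G) (sym p)))

  ≈-trans : ∀ {k} {a b c : RawWalk G k} → _≈L_ G a b → _≈L_ G b c → _≈L_ G a c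
  ≈-trans (inj₁ p) (inj₁ q) = inj₁ (trans p q)
  ≈-trans (inj₁ p) (inj₂ q) = inj₂ (trans p q)
  ≈-trans (inj₂ p) (inj₁ q) = inj₂ (trans p (cong (rev G) q))
  ≈-trans {c = c} (inj₂ p) (inj₂ q) = inj₁ (trans p (trans (cong (rev G) q) (rev-involutive c)))

  ≈-rev : ∀ {k} (w : RawWalk G k) → _≈L_ G (rev G w) w
  ≈-rev w = inj₂ refl

  middle-prefix : ∀ {j} (w : RawWalk G (suc (suc j))) → middle G w ≡ suffix G (prefix G w)
  middle-prefix (vs , es) = cong₂ _,_ (init-tail vs) (init-tail es)

  middle-rev : ∀ {j} (w : RawWalk G (suc (suc j))) → middle G (rev G w) ≡ rev G (middle G w)
  middle-rev (vs , es) = cong₂ _,_ (init-tail-reverse vs) (init-tail-reverse es)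
    where
    open ≡-Reasoning
    init-tail-reverse : ∀ {A : Set} {n} (v : Vec A (suc (suc n))) → init (tail (reverse v)) ≡ reverse (init (tail v))
    init-tail-reverse v = begin
      init (tail (reverse v))  ≡⟨ cong init (tail-reverse v) ⟩
      init (reverse (init v))  ≡⟨ init-reverse (init v) ⟩
      reverse (tail (init v))  ≡⟨ cong reverse (sym (init-tail v)) ⟩
      reverse (init (tail v))  ∎

  prefix-rev : ∀ {k} (w : RawWalk G (suc k)) → prefix G (rev G w) ≡ rev G (suffix G w)
  prefix-rev (vs , es) = cong₂ _,_ (init-reverse vs) (init-reverse es)

  suffix-rev : ∀ {k} (w : RawWalk G (suc k)) → suffix G (rev G w) ≡ rev G (prefix G w)
  suffix-rev (vs , es) = cong₂ _,_ (tail-reverse vs) (tail-reverse es)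

  -- A link of length ≥ 1 is never its own reverse: otherwise its middle edge
  -- (or middle vertex pair) would be a loop or a repeated consecutive edge.
  link≢rev : ∀ i (y : RawWalk G (suc i)) → IsLink G (suc i) y → y ≢ rev G y
  link≢rev zero (a ∷ b ∷ [] , e ∷ []) l q = Joins-distinct (proj₁ (link-uncons l)) (cong (λ z → head (proj₁ z)) q)
  link≢rev (suc zero) (a ∷ b ∷ c ∷ [] , e ∷ f ∷ []) l q = proj₁ (proj₂ (link-uncons l)) (cong (λ z → head (proj₂ z)) q)
  link≢rev (suc (suc i)) y l q =
    link≢rev i (middle G y) (middle-link {w = y} l) (trans (cong (middle G) q) (middle-rev y))

  suffix≉prefix : ∀ j (x : RawWalk G (suc j)) → IsLink G (suc j) x → ¬ (_≈L_ G (suffix G x) (prefix G x))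
  suffix≉prefix j (a ∷ b ∷ xv , e ∷ xe) l (inj₁ q) =
    Joins-distinct (proj₁ (link-uncons l)) (sym (cong (λ z → head (proj₁ z)) q))
  suffix≉prefix zero (a ∷ b ∷ [] , e ∷ []) l (inj₂ q) =
    Joins-distinct (proj₁ (link-uncons l)) (sym (cong (λ z → head (proj₁ z)) q))
  suffix≉prefix (suc zero) (a ∷ b ∷ c ∷ [] , e ∷ f ∷ []) l (inj₂ q) =
    proj₁ (proj₂ (link-uncons l)) (sym (cong (λ z → head (proj₂ z)) q))
  suffix≉prefix (suc (suc j)) x l (inj₂ q) =
    link≢rev j (middle G x) (middle-link {w = x} l) (begin
      middle G x                     ≡⟨⟩
      prefix G (suffix G x)          ≡⟨ cong (prefix G) q ⟩
      prefix G (rev G (prefix G x))  ≡⟨ prefix-rev (prefix G x) ⟩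
      rev G (suffix G (prefix G x))  ≡⟨ cong (rev G) (sym (middle-prefix x)) ⟩
      rev G (middle G x)             ∎)
    where open ≡-Reasoning

module PartDegree (G : Graph) where
  open Incidence G
  open Links G

  InPartAt : ∀ {j} → RawWalk G (suc (suc j)) → RawWalk G (suc j) → RawWalk G (suc (suc j)) → Set
  InPartAt {j} w x w' = IsLink G (suc (suc j)) w' × _≈L_ G (middle G w') (middle G w) × Incident G w' x

  degPart-vertex-cong : ∀ {j d} {w : RawWalk G (suc (suc j))} {x y : RawWalk G (suc j)} →
    _≈L_ G x y → degPart G w x d → degPart G w y d
  degPart-vertex-cong {w = w} {x} {y} xy =
    card-cong {_≈_ = _≈L_ G} {P = InPartAt w x} {Q = InPartAt w y}
      (λ w' (l , m , i) → l , m , along {w'} xy i) (λ w' (l , m , i) → l , m , along {w'} (≈-sym xy) i)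
    where
    along : ∀ {w' x y} → _≈L_ G x y → Incident G w' x → Incident G w' y
    along xy (inj₁ p) = inj₁ (≈-trans p xy)
    along xy (inj₂ p) = inj₂ (≈-trans p xy)

  degPart-part-cong : ∀ {j d} {w w' : RawWalk G (suc (suc j))} {x : RawWalk G (suc j)} →
    _≈L_ G (middle G w) (middle G w') → degPart G w x d → degPart G w' x d
  degPart-part-cong {w = w} {w'} {x} mm =
    card-cong {_≈_ = _≈L_ G} {P = InPartAt w x} {Q = InPartAt w' x}
      (λ u (l , m , i) → l , ≈-trans m mm , i) (λ u (l , m , i) → l , ≈-trans m (≈-sym mm) , i)

  -- Let x = [h, f1, …] be a k-link and w = [a, e0, x] any walk
  -- extending it.  The links of the part of w incident to x are, up to reversal,
  -- exactly the extensions [u, e, x] of x by an edge e ≠ f1 at h; so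
  -- deg_E(x) = deg(h) − 1.
  module AtSuffix {j : ℕ} (h : V G) (f1 : E G) (xv : Vec (V G) (suc j)) (xe : Vec (E G) j)
                  (lx : IsLink G (suc j) (h ∷ xv , f1 ∷ xe)) where

    x : RawWalk G (suc j)
    x = h ∷ xv , f1 ∷ xe

    OtherEdge : E G → Set
    OtherEdge e = IsEnd G h e × e ≢ f1

    extend : E G → RawWalk G (suc (suc j))
    extend e = otherEnd h e ∷ h ∷ xv , e ∷ f1 ∷ xe

    extend-in-part : ∀ {a e0} e → OtherEdge e → InPartAt (a ∷ h ∷ xv , e0 ∷ f1 ∷ xe) x (extend e)
    extend-in-part e (ie , ne) = link-cons (otherEnd-joins ie) ne lx , inj₁ refl , inj₂ (inj₁ refl)

    -- Different edges give inequivalent extensions: the first edge of a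
    -- reversed extension is the last edge of x, which is also its own last edge.
    extend-injective : ∀ e e' → OtherEdge e → OtherEdge e' → _≈L_ G (extend e) (extend e') → e ≡ e'
    extend-injective e e' _ _ (inj₁ q) = cong (λ z → head (proj₂ z)) q
    extend-injective e e' _ _ (inj₂ q) = begin
      e                                     ≡⟨ cong (λ z → head (proj₂ z)) q ⟩
      head (reverse (e' ∷ f1 ∷ xe))         ≡⟨ head-reverse (e' ∷ f1 ∷ xe) ⟩
      last (e ∷ f1 ∷ xe)                    ≡⟨ cong (λ z → last (proj₂ z)) q ⟩
      last (reverse (e' ∷ f1 ∷ xe))         ≡⟨ last-reverse (e' ∷ f1 ∷ xe) ⟩
      e'                                    ∎
      where open ≡-Reasoning

    suffix-extends : (w' : RawWalk G (suc (suc j))) → IsLink G (suc (suc j)) w' → suffix G w' ≡ x →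
                     Σ (E G) λ g → OtherEdge g × extend g ≡ w'
    suffix-extends (p ∷ .h ∷ .xv , g ∷ .f1 ∷ .xe) l' refl with link-uncons l'
    ... | jg , ok , _ = g , (Joins-end (Joins-sym jg) , ok) , cong (λ z → z ∷ h ∷ xv , g ∷ f1 ∷ xe) (sym (otherEnd-unique jg))

    -- Every counted link is equivalent to an extension; a counted link whose
    -- prefix is x (or its reverse) would make x's suffix equivalent to its prefix.
    extend-surjective : ∀ {a e0} w' → InPartAt (a ∷ h ∷ xv , e0 ∷ f1 ∷ xe) x w' →
                        Σ (E G) λ g → OtherEdge g × _≈L_ G (extend g) w'
    extend-surjective w' (l' , mid , inj₂ (inj₁ q)) with suffix-extends w' l' q
    ... | g , og , eq = g , og , inj₁ eq
    extend-surjective w' (l' , mid , inj₁ (inj₂ q))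
      with suffix-extends (rev G w') (link-rev {w = w'} l') (trans (suffix-rev w') (trans (cong (rev G) q) (rev-involutive x)))
    ... | g , og , eq = g , og , inj₂ eq
    extend-surjective w' (l' , mid , inj₁ (inj₁ q)) = ⊥-elim (suffix≉prefix j x lx
      (subst (λ z → _≈L_ G (suffix G z) (prefix G x)) q (subst (λ z → _≈L_ G z (prefix G x)) (middle-prefix w') mid)))
    extend-surjective w' (l' , mid , inj₂ (inj₂ q)) = ⊥-elim (suffix≉prefix j x lx
      (≈-trans (≈-sym (≈-rev (suffix G x)))
        (subst (λ z → _≈L_ G z (prefix G x)) (trans (cong (prefix G) q) (prefix-rev x)) mid)))

    degPart-at-suffix : ∀ {a e0 d} → deg G h (suc d) → degPart G (a ∷ h ∷ xv , e0 ∷ f1 ∷ xe) x d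
    degPart-at-suffix {a} {e0} dh =
      card-transport {_≈_ = _≈L_ G} {Q = InPartAt (a ∷ h ∷ xv , e0 ∷ f1 ∷ xe) x}
        extend (extend-in-part {a} {e0}) extend-injective (extend-surjective {a} {e0})
        (card-remove f1 (Joins-end (link-first-edge {w = x} lx)) dh)

  Witness : ℕ → ℕ → Set
  Witness j d = Σ (RawWalk G (suc (suc j))) λ w → IsLink G (suc (suc j)) w × deg G (head (tail (proj₁ w))) (suc d)

  witness⇒Dk : ∀ j d → Witness j d → Dk G (suc j) d
  witness⇒Dk j d ((a ∷ h ∷ xv , e0 ∷ f1 ∷ xe) , lw , dh) =
    (h ∷ xv , f1 ∷ xe) , (a ∷ h ∷ xv , e0 ∷ f1 ∷ xe) , lx , lw , inj₂ (inj₁ refl) ,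
    AtSuffix.degPart-at-suffix h f1 xv xe lx {a} {e0} dh
    where
    lx : IsLink G (suc j) (h ∷ xv , f1 ∷ xe)
    lx = link-suffix {w = a ∷ h ∷ xv , e0 ∷ f1 ∷ xe} lw

  witness-from-suffix : ∀ j d (w : RawWalk G (suc (suc j))) → IsLink G (suc (suc j)) w →
    degPart G w (suffix G w) d → Witness j d
  witness-from-suffix j d w@(a ∷ h ∷ xv , e0 ∷ f1 ∷ xe) lw dp
    with deg-exists h
  ... | d'' , dh with card-nonzero dh (Joins-end (link-first-edge {w = suffix G w} (link-suffix {w = w} lw)))
  ... | d' , refl = w , lw , subst (λ z → deg G h (suc z)) (sym degree-match) dh
    where
    lx : IsLink G (suc j) (suffix G w)
    lx = link-suffix {w = w} lw
    degree-match : d ≡ d'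
    degree-match = card-unique ≈-sym ≈-trans dp (AtSuffix.degPart-at-suffix h f1 xv xe lx {a} {e0} dh)

  -- Every element of D_(j+1) has a witness: reverse w if necessary so that x
  -- becomes (equivalent to) its suffix.
  Dk⇒witness : ∀ j d → Dk G (suc j) d → Witness j d
  Dk⇒witness j d (x , w , lx , lw , inj₂ sx , dp) =
    witness-from-suffix j d w lw (degPart-vertex-cong {w = w} (≈-sym sx) dp)
  Dk⇒witness j d (x , w , lx , lw , inj₁ px , dp) =
    witness-from-suffix j d (rev G w) (link-rev {w = w} lw)
      (subst (λ z → degPart G (rev G w) z d) (sym (suffix-rev w))
        (degPart-vertex-cong {w = rev G w} (≈-trans (≈-sym px) (≈-sym (≈-rev (prefix G w))))
          (degPart-part-cong {w = w} {w' = rev G w}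
            (subst (_≈L_ G (middle G w)) (sym (middle-rev w)) (≈-sym (≈-rev (middle G w)))) dp)))

-- Walks.  A k-link is the same thing as a non-backtracking walk of length k.

module Walks (G : Graph) where
  open Incidence G
  open Links G

  Walk : ℕ → V G → V G → Set
  Walk = Reach G

  raw : ∀ {k u w} → Walk k u w → RawWalk G k
  raw (here {u}) = u ∷ [] , []
  raw (there {u = u} (e , j) r) = u ∷ proj₁ (raw r) , e ∷ proj₂ (raw r)

  raw-head : ∀ {k u w} (r : Walk k u w) → head (proj₁ (raw r)) ≡ u
  raw-head here = refl
  raw-head (there a r) = refl

  FirstEdgeNot : ∀ {k u w} → E G → Walk k u w → Set
  FirstEdgeNot e here = ⊤
  FirstEdgeNot e (there a r) = e ≢ proj₁ a

  NonBacktracking : ∀ {k u w} → Walk k u w → Set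
  NonBacktracking here = ⊤
  NonBacktracking (there a r) = FirstEdgeNot (proj₁ a) r × NonBacktracking r

  raw-link : ∀ {k u w} (r : Walk k u w) → NonBacktracking r → IsLink G k (raw r)
  raw-link (here {u}) _ = link-zero (u ∷ []) []
  raw-link (there (e , j) r) (ok , nb) =
    link-cons {vs = proj₁ (raw r)} {es = proj₂ (raw r)} (subst (Joins G e _) (sym (raw-head r)) j) (consOK r ok) (raw-link r nb)
    where
    consOK : ∀ {k u w} (r : Walk k u w) → FirstEdgeNot e r → ConsOK e (proj₂ (raw r))
    consOK here _ = tt
    consOK (there a r) ok = ok

  FirstEdgeIs : ∀ {k u w} → Walk k u w → Vec (E G) k → Set
  FirstEdgeIs here [] = ⊤
  FirstEdgeIs (there a r) (f ∷ _) = proj₁ a ≡ f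

  firstEdgeIs-not : ∀ {k u w e} (r : Walk k u w) (es : Vec (E G) k) → FirstEdgeIs r es → ConsOK e es → FirstEdgeNot e r
  firstEdgeIs-not here [] _ _ = tt
  firstEdgeIs-not (there a r) (f ∷ es) p ok q = ok (trans q p)

  link-walk : ∀ k (w : RawWalk G k) → IsLink G k w →
    Σ (Walk k (head (proj₁ w)) (last (proj₁ w))) λ r → NonBacktracking r × FirstEdgeIs r (proj₂ w)
  link-walk zero (a ∷ [] , []) l = here , tt , tt
  link-walk (suc k) (a ∷ b ∷ vs , e ∷ es) l with link-uncons {vs = b ∷ vs} {es = es} l
  ... | j , ok , l' with link-walk k (b ∷ vs , es) l'
  ... | r , nb , fe = there (e , j) r , (firstEdgeIs-not r es fe ok , nb) , refl

  remove-backtracking : ∀ {k u w} → Walk k u w → Σ ℕ λ k' → k' ≤ k × Σ (Walk k' u w) NonBacktracking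
  remove-backtracking here = 0 , z≤n , here , tt
  remove-backtracking (there (e , j) r) with remove-backtracking r
  ... | k' , le , here , _ = 1 , s≤s z≤n , there (e , j) here , tt , tt
  ... | suc k'' , le , there (e' , j') r' , nb with e ≟ e'
  ...   | no ne = suc (suc k'') , s≤s le , there (e , j) (there (e' , j') r') , ne , nb
  ...   | yes refl with Joins-other-end (Joins-sym j) j'
  ...     | refl = k'' , m≤n⇒m≤1+n (≤-trans (m≤n⇒m≤1+n ≤-refl) le) , r' , proj₂ nb

  _++W_ : ∀ {k m u v w} → Walk k u v → Walk m v w → Walk (k + m) u w
  here ++W s = s
  there a r ++W s = there a (r ++W s)

  JoinsNonBacktracking : ∀ {k m u v w} → Walk k u v → Walk m v w → Set
  JoinsNonBacktracking here s = ⊤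
  JoinsNonBacktracking (there a here) s = FirstEdgeNot (proj₁ a) s
  JoinsNonBacktracking (there a (there b r)) s = JoinsNonBacktracking (there b r) s

  nonBacktracking-++ : ∀ {k m u v w} (r : Walk k u v) (s : Walk m v w) → NonBacktracking r → NonBacktracking s →
    JoinsNonBacktracking r s → NonBacktracking (r ++W s)
  nonBacktracking-++ here s _ ns _ = ns
  nonBacktracking-++ (there a here) s _ ns j = j , ns
  nonBacktracking-++ (there a (there b r)) s (ok , nr) ns j = ok , nonBacktracking-++ (there b r) s nr ns j

  SameFirstEdge : ∀ {m k u w w'} → Walk m u w' → Walk k u w → Set
  SameFirstEdge here _ = ⊤
  SameFirstEdge (there b _) here = ⊥
  SameFirstEdge (there b _) (there b' _) = proj₁ b ≡ proj₁ b'

  sameFirstEdge-not : ∀ {m k u w w' e} (t : Walk m u w') (r : Walk k u w) → SameFirstEdge t r →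
    FirstEdgeNot e r → FirstEdgeNot e t
  sameFirstEdge-not here r _ _ = tt
  sameFirstEdge-not (there b t) (there b' r) p ok q = ok (trans q p)

  initial-segment : ∀ m {k u w} → m ≤ k → (r : Walk k u w) → NonBacktracking r →
    Σ (V G) λ w' → Σ (Walk m u w') λ t → NonBacktracking t × SameFirstEdge t r
  initial-segment zero le r nb = _ , here , tt , tt
  initial-segment (suc m) (s≤s le) (there a r) (ok , nb) with initial-segment m le r nb
  ... | w' , t , nt , fs = w' , there a t , (sameFirstEdge-not t r fs ok , nt) , refl

  two-step : ∀ {v g g'} → IsEnd G v g → IsEnd G v g' → Walk 2 (otherEnd v g) (otherEnd v g')
  two-step ie ie' = there (_ , otherEnd-joins ie) (there (_ , Joins-sym (otherEnd-joins ie')) here)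

-- With a cycle, every vertex v of degree ≥ 2 is the second vertex of
-- arbitrarily long links: a non-backtracking walk from v to the cycle continued
-- around the cycle is arbitrarily long, and an edge at v other than its first
-- edge extends it backwards.

module CycleCase (G : Graph) where
  open Incidence G
  open PartDegree G
  open Walks G

  -- A closed walk c 0, …, c (k+1) whose edges ed i (from c i to c (i+1 mod k+2))
  -- are distinct.
  module AroundCycle (k : ℕ) (c : Fin (suc (suc k)) → V G) (ed : Fin (suc (suc k)) → E G)
             (edinj : ∀ i j → ed i ≡ ed j → i ≡ j)
             (J : ∀ (i : Fin (suc k)) → Joins G (ed (inject₁ i)) (c (inject₁ i)) (c (fsuc i)))
             (JL : Joins G (ed (fromℕ (suc k))) (c (fromℕ (suc k))) (c fzero)) where

    K : ℕ
    K = suc (suc k)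

    cycle-step : (i : Fin K) → Σ (Fin K) λ i' → Joins G (ed i) (c i) (c i') × i' ≢ i
    cycle-step i with view i
    ... | ‵fromℕ = fzero , JL , λ ()
    ... | ‵inj₁ {i = i'} _ = fsuc i' , J i' , λ q → 1+n≢n (trans (cong toℕ q) (toℕ-inject₁ i'))

    StartsWith : ∀ {n u w} → E G → Walk n u w → Set
    StartsWith e here = ⊤
    StartsWith e (there a _) = proj₁ a ≡ e

    -- Going n steps around the cycle from c i is non-backtracking, since the
    -- cycle edges are distinct.
    go-around : (i : Fin K) (n : ℕ) → Σ (V G) λ u → Σ (Walk n (c i) u) λ r → NonBacktracking r × StartsWith (ed i) r
    go-around i zero = c i , here , tt , tt
    go-around i (suc n) with cycle-step i
    ... | i' , j , ne with go-around i' n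
    ... | u , r , nb , fi = u , there (ed i , j) r , (next-edge-differs r fi , nb) , refl
      where
      next-edge-differs : ∀ {n u} (r : Walk n (c i') u) → StartsWith (ed i') r → FirstEdgeNot (ed i) r
      next-edge-differs here _ = tt
      next-edge-differs (there a r) fi q = ne (sym (edinj _ _ (trans q fi)))

    OnCycle : V G → Set
    OnCycle u = Σ (Fin K) λ i → c i ≡ u

    CycleEdge : E G → Set
    CycleEdge e = Σ (Fin K) λ i → e ≡ ed i

    LastEdgeOffCycle : ∀ {n u w} → Walk n u w → Set
    LastEdgeOffCycle here = ⊤
    LastEdgeOffCycle (there a here) = ¬ CycleEdge (proj₁ a)
    LastEdgeOffCycle (there a (there b r)) = LastEdgeOffCycle (there b r)

    lastEdgeOffCycle-cons : ∀ {n u v w} (a : Adj G u v) (q : Walk n v w) → ¬ OnCycle u →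
      LastEdgeOffCycle q → LastEdgeOffCycle (there a q)
    lastEdgeOffCycle-cons (e , ja) here nu _ (i , p) with cycle-step i
    ... | i' , ji , _ with Joins-ends (subst (λ z → Joins G z _ _) p ja) ji
    ...   | inj₁ q = nu (i , sym q)
    ...   | inj₂ q = nu (i' , sym q)
    lastEdgeOffCycle-cons a (there b q) nu ln = ln

    stop-at-cycle : ∀ {n u w} → OnCycle w → (r : Walk n u w) → NonBacktracking r →
      Σ ℕ λ n' → Σ (Fin K) λ j → Σ (Walk n' u (c j)) λ q → NonBacktracking q × SameFirstEdge q r × LastEdgeOffCycle q
    stop-at-cycle {u = u} oc r nb with any? (λ i → c i ≟ u)
    ... | yes (i , refl) = 0 , i , here , tt , tt , tt
    ... | no np with r
    ...   | here = ⊥-elim (np oc)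
    ...   | there a r' with stop-at-cycle oc r' (proj₂ nb)
    ...     | n' , j , q , nq , fs , ln =
              suc n' , j , there a q , (sameFirstEdge-not q r' fs (proj₁ nb) , nq) , refl , lastEdgeOffCycle-cons a q np ln

    join-at-cycle : ∀ {n m u v w i} (q : Walk n u v) (s : Walk m v w) → LastEdgeOffCycle q → StartsWith (ed i) s →
      JoinsNonBacktracking q s
    join-at-cycle here s _ _ = tt
    join-at-cycle (there a here) here _ _ = tt
    join-at-cycle (there a here) (there b s) ln fi q = ln (_ , trans q fi)
    join-at-cycle (there a (there b r)) s ln fi = join-at-cycle (there b r) s ln fi

    -- The route v → cycle → around is a long non-backtracking walk from v; its
    -- first edge f is avoided by another edge g at v, and [g, f, …] is the witness.
    cycle-witness : Connected G → ∀ j d v → deg G v (suc d) → 1 ≤ d → Witness j d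
    cycle-witness conn j d v dv d1 with remove-backtracking (proj₂ (conn v (c fzero)))
    ... | _ , _ , r , nb with stop-at-cycle (fzero , refl) r nb
    ... | n' , j0 , q , nq , _ , ln with go-around j0 (suc j)
    ... | _ , s , ns , fi
      with initial-segment (suc j) (m≤n+m (suc j) n') (q ++W s) (nonBacktracking-++ q s nq ns (join-at-cycle q s ln fi))
    ... | u' , there (f , jf) t , nt , _ with card-avoid dv d1 f
    ... | g , ie , ne = raw link , raw-link link (ne , nt) , dv
      where
      link : Walk (suc (suc j)) (otherEnd v g) u'
      link = there (g , otherEnd-joins ie) (there (f , jf) t)

-- Forests: without cycles, non-backtracking walks are shortest walks.

module Forests (G : Graph) where
  open Incidence G
  open Walks G

  vertices : ∀ {k u w} → Walk k u w → Vec (V G) (suc k)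
  vertices r = proj₁ (raw r)

  edgeList : ∀ {k u w} → Walk k u w → Vec (E G) k
  edgeList r = proj₂ (raw r)

  first-vertex : ∀ {k u w} (r : Walk k u w) → lookup (vertices r) fzero ≡ u
  first-vertex here = refl
  first-vertex (there a r) = refl

  last-vertex : ∀ {k u w} (r : Walk k u w) → lookup (vertices r) (fromℕ k) ≡ w
  last-vertex here = refl
  last-vertex (there a r) = last-vertex r

  walk-joins : ∀ {k u w} (r : Walk k u w) (i : Fin k) →
    Joins G (lookup (edgeList r) i) (lookup (vertices r) (inject₁ i)) (lookup (vertices r) (fsuc i))
  walk-joins (there (e , j) r) fzero = subst (Joins G e _) (sym (first-vertex r)) j
  walk-joins (there a r) (fsuc i) = walk-joins r i

  Visits : ∀ {k u w} → V G → Walk k u w → Set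
  Visits x (here {u}) = x ≡ u
  Visits x (there {u = u} a r) = x ≡ u ⊎ Visits x r

  visits? : ∀ {k u w} (x : V G) (r : Walk k u w) → Dec (Visits x r)
  visits? x (here {u}) = x ≟ u
  visits? x (there {u = u} a r) = (x ≟ u) ⊎-dec (visits? x r)

  visits-end : ∀ {k u w} (r : Walk k u w) → Visits w r
  visits-end here = refl
  visits-end (there a r) = inj₂ (visits-end r)

  visits-lookup : ∀ {k u w} (r : Walk k u w) (i : Fin (suc k)) → Visits (lookup (vertices r) i) r
  visits-lookup here fzero = refl
  visits-lookup (there a r) fzero = inj₁ refl
  visits-lookup (there a r) (fsuc i) = inj₂ (visits-lookup r i)

  Simple : ∀ {k u w} → Walk k u w → Set
  Simple here = ⊤
  Simple (there {u = u} a r) = ¬ Visits u r × Simple r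

  simple-vertices-injective : ∀ {k u w} (r : Walk k u w) → Simple r →
    ∀ i j → lookup (vertices r) i ≡ lookup (vertices r) j → i ≡ j
  simple-vertices-injective here _ fzero fzero _ = refl
  simple-vertices-injective (there a r) s fzero fzero _ = refl
  simple-vertices-injective (there a r) (nv , s) fzero (fsuc j) q = ⊥-elim (nv (subst (λ z → Visits z r) (sym q) (visits-lookup r j)))
  simple-vertices-injective (there a r) (nv , s) (fsuc i) fzero q = ⊥-elim (nv (subst (λ z → Visits z r) q (visits-lookup r i)))
  simple-vertices-injective (there a r) (nv , s) (fsuc i) (fsuc j) q = cong fsuc (simple-vertices-injective r s i j q)

  -- The edges of a path are distinct, as each has an end not visited later.
  simple-edges-injective : ∀ {k u w} (r : Walk k u w) → Simple r →
    ∀ i j → lookup (edgeList r) i ≡ lookup (edgeList r) j → i ≡ j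
  simple-edges-injective (there a r) s fzero fzero _ = refl
  simple-edges-injective (there (e , je) r) (nv , s) fzero (fsuc j) q =
    ⊥-elim (nv (visited (Joins-ends (subst (λ z → Joins G z _ _) q je) (walk-joins r j))))
    where
    visited : _ ⊎ _ → Visits _ r
    visited (inj₁ p) = subst (λ z → Visits z r) (sym p) (visits-lookup r (inject₁ j))
    visited (inj₂ p) = subst (λ z → Visits z r) (sym p) (visits-lookup r (fsuc j))
  simple-edges-injective (there a r) s (fsuc i) fzero q = sym (simple-edges-injective (there a r) s fzero (fsuc i) (sym q))
  simple-edges-injective (there a r) (nv , s) (fsuc i) (fsuc j) q = cong fsuc (simple-edges-injective r s i j q)

  cut-at : ∀ {k u w x} (r : Walk k u w) → Visits x r → Σ ℕ λ n → Σ (Walk n u x) λ r1 →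
    SameFirstEdge r1 r × (NonBacktracking r → NonBacktracking r1) × (Simple r → Simple r1) × (∀ y → Visits y r1 → Visits y r)
  cut-at here refl = 0 , here , tt , (λ _ → tt) , (λ _ → tt) , λ y m → m
  cut-at (there a r) (inj₁ refl) = 0 , here , tt , (λ _ → tt) , (λ _ → tt) , λ y m → inj₁ m
  cut-at (there a r) (inj₂ m) with cut-at r m
  ... | n , r1 , fs , nbp , sp , ms = suc n , there a r1 , refl ,
        (λ { (ok , nb) → sameFirstEdge-not r1 r fs ok , nbp nb }) ,
        (λ { (nv , s) → (λ m1 → nv (ms _ m1)) , sp s }) ,
        λ { y (inj₁ p) → inj₁ p ; y (inj₂ p) → inj₂ (ms y p) }

  cycle-from-walk : ∀ {k u v'} (e0 : E G) (j0 : Joins G e0 u v') (r1 : Walk (suc k) v' u) → Simple r1 →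
    NonBacktracking (there (e0 , j0) r1) → HasCycle G
  cycle-from-walk {k} {u} {v'} e0 j0 r1@(there (f , jf) r2) s nb = k , c , ed , c-injective , ed-injective , J , JL
    where
    closed : Walk (suc (suc k)) u u
    closed = there (e0 , j0) r1
    closed-link : IsLink G (suc (suc k)) (raw closed)
    closed-link = raw-link closed nb
    c : Fin (suc (suc k)) → V G
    c i = lookup (vertices closed) (inject₁ i)
    ed : Fin (suc (suc k)) → E G
    ed i = lookup (edgeList closed) i
    J : ∀ (i : Fin (suc k)) → Joins G (ed (inject₁ i)) (c (inject₁ i)) (c (fsuc i))
    J i = proj₁ closed-link (inject₁ i)
    JL : Joins G (ed (fromℕ (suc k))) (c (fromℕ (suc k))) (c fzero)
    JL = subst (Joins G _ _) (last-vertex r1) (proj₁ closed-link (fromℕ (suc k)))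
    u-not-inner : ∀ j → u ≢ lookup (vertices r1) (inject₁ j)
    u-not-inner j q = fromℕ≢inject₁ {i = j} (simple-vertices-injective r1 s _ _ (trans (last-vertex r1) q))
    c-injective : ∀ i j → c i ≡ c j → i ≡ j
    c-injective fzero fzero _ = refl
    c-injective (fsuc i) (fsuc j) q = cong fsuc (inject₁-injective (simple-vertices-injective r1 s _ _ q))
    c-injective fzero (fsuc j) q = ⊥-elim (u-not-inner j q)
    c-injective (fsuc i) fzero q = ⊥-elim (u-not-inner i (sym q))
    -- e0 is not an edge of r1: its ends are the first and last vertex of r1,
    -- so it could only be the first edge of r1, excluded by non-backtracking.
    e0-not-in-r1 : ∀ j → e0 ≢ lookup (edgeList r1) j
    e0-not-in-r1 j q with Joins-ends (subst (λ z → Joins G z v' u) q (Joins-sym j0)) (walk-joins r1 j)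
    ... | inj₂ p = Fin.0≢1+n (simple-vertices-injective r1 s _ _ (trans (first-vertex r1) p))
    ... | inj₁ p = first-edge j (simple-vertices-injective r1 s _ _ (trans (first-vertex r1) p)) q
      where
      first-edge : ∀ j → fzero ≡ inject₁ j → e0 ≢ lookup (edgeList r1) j
      first-edge fzero _ = proj₁ nb
      first-edge (fsuc j) ()
    ed-injective : ∀ i j → ed i ≡ ed j → i ≡ j
    ed-injective fzero fzero _ = refl
    ed-injective (fsuc i) (fsuc j) q = cong fsuc (simple-edges-injective r1 s i j q)
    ed-injective fzero (fsuc j) q = ⊥-elim (e0-not-in-r1 j q)
    ed-injective (fsuc i) fzero q = ⊥-elim (e0-not-in-r1 i (sym q))

  -- A non-backtracking walk is a path unless G has a cycle: at the first
  -- repeated vertex, the walk between the two visits closes a cycle.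
  simple-or-cycle : ∀ {k u w} (r : Walk k u w) → NonBacktracking r → Simple r ⊎ HasCycle G
  simple-or-cycle here _ = inj₁ tt
  simple-or-cycle (there {u = u} a r') (ok , nb') with simple-or-cycle r' nb'
  ... | inj₂ h = inj₂ h
  ... | inj₁ s' with visits? u r'
  ...   | no nv = inj₁ (nv , s')
  ...   | yes m with cut-at r' m
  ...     | zero , here , fs , nbp , sp , ms = ⊥-elim (Joins-distinct (proj₂ a) refl)
  ...     | suc n , there b r1 , fs , nbp , sp , ms =
            inj₂ (cycle-from-walk (proj₁ a) (proj₂ a) (there b r1) (sp s') (sameFirstEdge-not (there b r1) r' fs ok , nbp nb'))

  closed-walk-cycle : ∀ {n v} (r : Walk n v v) → NonBacktracking r → n ≢ 0 → HasCycle G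
  closed-walk-cycle here _ nz = ⊥-elim (nz refl)
  closed-walk-cycle (there a r') nb nz with simple-or-cycle (there a r') nb
  ... | inj₂ h = h
  ... | inj₁ (nv , _) = ⊥-elim (nv (visits-end r'))

  -- Addition recursing on the first argument, matching `reverse-onto`.
  _+r_ : ℕ → ℕ → ℕ
  zero +r m = m
  suc k +r m = k +r suc m

  +r-suc : ∀ k m → k +r suc m ≡ suc (k +r m)
  +r-suc zero m = refl
  +r-suc (suc k) m = +r-suc k (suc m)

  reverse-onto : ∀ {k m u v w} → Walk k u v → Walk m u w → Walk (k +r m) v w
  reverse-onto here acc = acc
  reverse-onto (there (e , j) r) acc = reverse-onto r (there (e , Joins-sym j) acc)

  FirstEdgesDiffer : ∀ {k m u v w} → Walk k u v → Walk m u w → Set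
  FirstEdgesDiffer here _ = ⊤
  FirstEdgesDiffer (there a _) acc = FirstEdgeNot (proj₁ a) acc

  reverse-onto-nonBacktracking : ∀ {k m u v w} (r : Walk k u v) (acc : Walk m u w) →
    NonBacktracking r → NonBacktracking acc → FirstEdgesDiffer r acc → NonBacktracking (reverse-onto r acc)
  reverse-onto-nonBacktracking here acc _ na _ = na
  reverse-onto-nonBacktracking (there {v = x} (e , j) r) acc (ok , nr) na d =
    reverse-onto-nonBacktracking r (there (e , Joins-sym j) acc) nr (d , na) (differs r ok)
    where
    differs : ∀ {k v'} (r : Walk k x v') → FirstEdgeNot e r → FirstEdgesDiffer r (there {u = x} (e , Joins-sym j) acc)
    differs here _ = tt
    differs (there b r) ok q = ok (sym q)

  -- In a forest, non-backtracking walks with the same ends have the same length: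
  -- after their common first steps, one reversed followed by the other is a
  -- closed non-backtracking walk.
  nonBacktracking-length-unique : ¬ HasCycle G → ∀ {k m u v} (p : Walk k u v) (q : Walk m u v) →
    NonBacktracking p → NonBacktracking q → k ≡ m
  nonBacktracking-length-unique nc here here _ _ = refl
  nonBacktracking-length-unique nc here (there a q) _ nq = ⊥-elim (nc (closed-walk-cycle (there a q) nq (λ ())))
  nonBacktracking-length-unique nc (there a p) here np _ = ⊥-elim (nc (closed-walk-cycle (there a p) np (λ ())))
  nonBacktracking-length-unique nc {suc k} {suc m} (there (e , je) p) (there (e' , je') q) np nq with e ≟ e'
  ... | yes refl with Joins-other-end je je'
  ...   | refl = cong suc (nonBacktracking-length-unique nc p q (proj₂ np) (proj₂ nq))
  nonBacktracking-length-unique nc {suc k} {suc m} {u} {v} (there (e , je) p) (there (e' , je') q) np nq | no ne =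
    ⊥-elim (nc (closed-walk-cycle (reverse-onto p′ q′) (reverse-onto-nonBacktracking p′ q′ np nq ne)
      (λ z → 0≢1+n (sym (trans (sym (+r-suc k (suc m))) z)))))
    where
    p′ : Walk (suc k) u v
    p′ = there (e , je) p
    q′ : Walk (suc m) u v
    q′ = there (e' , je') q

  nonBacktracking-distance : ¬ HasCycle G → ∀ {L u v} (r : Walk L u v) → NonBacktracking r → Dist G u v L
  nonBacktracking-distance nc {L} r nb = r , no-shorter
    where
    no-shorter : ∀ k → k < L → ¬ Walk k _ _
    no-shorter k k<L r2 with remove-backtracking r2
    ... | k' , le , r3 , nb3 = 1+n≰n (≤-trans k<L (subst (_≤ k) (sym (nonBacktracking-length-unique nc r r3 nb nb3)) le))

  dist-unique : ∀ {u v d d'} → Dist G u v d → Dist G u v d' → d ≡ d'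
  dist-unique {d = d} {d'} (r , m) (r' , m') with <-cmp d d'
  ... | tri< a _ _ = ⊥-elim (m' d a r)
  ... | tri≈ _ b _ = b
  ... | tri> _ _ c = ⊥-elim (m d' c r')

module DegreeSets (G : Graph) where
  open Incidence G
  open Links G
  open PartDegree G
  open Walks G

  witness⇒DG : ∀ j d → Witness j d → DG G d
  witness⇒DG j d ((a ∷ b ∷ c ∷ vs , e ∷ f ∷ es) , lw , dh) with link-uncons {vs = b ∷ c ∷ vs} {es = f ∷ es} lw
  ... | je , ok , l' with link-uncons {vs = c ∷ vs} {es = es} l'
  ... | jf , _ , _ = card-two-distinct dh (Joins-end (Joins-sym je)) (Joins-end jf) ok , b , dh

  DG⇒witness : ∀ d → DG G d → Witness 0 d
  DG⇒witness d (d1 , v , dv) with card-pair dv d1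
  ... | g , g' , ie , ie' , ne = raw (two-step ie ie') , raw-link (two-step ie ie') (ne , tt , tt) , dv

  DG≐D1 : DG G ≐ Dk G 1
  DG≐D1 d = (λ dg → witness⇒Dk 0 d (DG⇒witness d dg)) , (λ dk → witness⇒DG 0 d (Dk⇒witness 0 d dk))

  witness-prefix : ∀ j d → Witness (suc j) d → Witness j d
  witness-prefix j d ((vs , es) , lw , dh) =
    prefix G (vs , es) , link-prefix {w = vs , es} lw , subst (λ z → deg G z (suc d)) (sym (head-tail-init vs)) dh

  Dk-mono : ∀ k → 1 ≤ k → Dk G (suc k) ⊆ Dk G k
  Dk-mono (suc j) _ d dk = witness⇒Dk j d (witness-prefix j d (Dk⇒witness (suc j) d dk))

  cycle-case : Connected G → ∀ ℓ → 1 ≤ ℓ → HasCycle G → DG G ≐ Dk G ℓ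
  cycle-case conn (suc j) _ (k , c , ed , _ , ed-injective , J , JL) d =
    (λ { (d1 , v , dv) → witness⇒Dk j d (CycleCase.AroundCycle.cycle-witness G k c ed ed-injective J JL conn j d v dv d1) }) ,
    (λ dk → witness⇒DG j d (Dk⇒witness j d dk))

  -- If G has diameter s ≥ 2, a shortest walk between two vertices at
  -- distance s is an s-link, so D_(s−1) is nonempty.
  Dk-diameter-nonempty : ∀ s → Diameter G s → 2 ≤ s → Nonempty (Dk G (s ∸ 1))
  Dk-diameter-nonempty zero _ ()
  Dk-diameter-nonempty (suc zero) _ (s≤s ())
  Dk-diameter-nonempty (suc (suc j)) ((u , v , r , minimal) , _) _ with remove-backtracking r
  ... | k' , le , r' , nb with m≤n⇒m<n∨m≡n le
  ... | inj₁ shorter = ⊥-elim (minimal k' shorter r')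
  ... | inj₂ refl with r' | nb
  ... | there (e1 , j1) (there (e2 , j2) r'') | nb' with deg-exists _
  ... | _ , dh with card-nonzero dh (Joins-end (Joins-sym j1))
  ... | d , refl = d , witness⇒Dk j d (raw path , raw-link path nb' , dh)
    where
    path : Walk (suc (suc j)) u v
    path = there (e1 , j1) (there (e2 , j2) r'')

module TreeDiameter (G : Graph) (acyclic : ¬ HasCycle G) where
  open Walks G
  open Forests G

  distance : Connected G → ∀ u v → Σ ℕ (Dist G u v)
  distance conn u v with remove-backtracking (proj₂ (conn u v))
  ... | k , _ , r , nb = k , nonBacktracking-distance acyclic r nb

  tree-diameter : Connected G → V G → Σ ℕ (Diameter G)
  tree-diameter conn v0 = s , (u₀ , far u₀ , proj₂ (distance conn u₀ (far u₀))) , bounded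
    where
    δ : V G → V G → ℕ
    δ u v = proj₁ (distance conn u v)
    far : V G → V G
    far u = proj₁ (argmax-nonempty v0 (δ u))
    eccentricity : V G → ℕ
    eccentricity u = δ u (far u)
    u₀ : V G
    u₀ = proj₁ (argmax-nonempty v0 eccentricity)
    s : ℕ
    s = eccentricity u₀
    bounded : ∀ u v d → Dist G u v d → d ≤ s
    bounded u v d D = subst (_≤ s) (sym (dist-unique D (proj₂ (distance conn u v))))
      (≤-trans (proj₂ (argmax-nonempty v0 (δ u)) v) (proj₂ (argmax-nonempty v0 eccentricity) u))

  nonBacktracking-≤-diameter : ∀ {s L u v} → Diameter G s → (r : Walk L u v) → NonBacktracking r → L ≤ s
  nonBacktracking-≤-diameter diam r nb = proj₂ diam _ _ _ (nonBacktracking-distance acyclic r nb)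

  two≤diameter : ∀ {s} → Diameter G s → MaxDeg≥2 G → 2 ≤ s
  two≤diameter diam (v , suc d , dv , s≤s d1) with card-pair dv d1
  ... | e , e' , ie , ie' , ne = nonBacktracking-≤-diameter diam (two-step ie ie') (ne , tt , tt)

  -- ... and D_k = ∅ for k ≥ s, as an element of D_k needs a (k+1)-link.
  Dk-empty : ∀ {s} → Diameter G s → ∀ k → s ≤ k → Empty (Dk G k)
  Dk-empty diam zero _ d ()
  Dk-empty diam (suc j) le d (x , w , lx , lw , _) with link-walk (suc (suc j)) w lw
  ... | r , nb , _ = 1+n≰n (≤-trans (nonBacktracking-≤-diameter diam r nb) le)

lemma6p5 : (ℓ : ℕ) → 1 ≤ ℓ → (G : Graph) → Connected G → MaxDeg≥2 G →
    (HasCycle G → DG G ≐ Dk G ℓ)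
    × (¬ HasCycle G →
        Σ ℕ λ s → 2 ≤ s × Diameter G s
          × (DG G ≐ Dk G 1)
          × (∀ k → 1 ≤ k → suc k ≤ s ∸ 1 → Dk G (suc k) ⊆ Dk G k)
          × Nonempty (Dk G (s ∸ 1))
          × (∀ k → s ≤ k → Empty (Dk G k)))
lemma6p5 ℓ 1≤ℓ G conn Δ≥2 =
    DegreeSets.cycle-case G conn ℓ 1≤ℓ
  , λ acyclic →
      let open DegreeSets G
          open TreeDiameter G acyclic
          (s , diam) = tree-diameter conn (proj₁ Δ≥2)
          2≤s = two≤diameter diam Δ≥2
      in s , 2≤s , diam , DG≐D1 , (λ k 1≤k _ → Dk-mono k 1≤k) , Dk-diameter-nonempty s diam 2≤s , Dk-empty diam
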